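{- Let $\mathbb{D}:=\{(2r+1)/2^k:r,k\in\mathbb{Z}\}$ and let $\operatorname{Adic}_2:\mathbb{D}\cap[0,1)\rightrightarrows\{0,1\}^\omega$ be the multivalued mapping sending $x$ to the set of all sequences $(b_1,b_2,\ldots)\in\{0,1\}^\omega$ with $x=\sum_{m\ge1}b_m2^{ -m}$. Then for no $d\in\mathbb{N}$ is $\operatorname{Adic}_2$ $d$-wise $(\rho,\nu^\omega)$-continuous.
   Context: $\rho$ is the Cauchy representation of $\mathbb{R}$ (a name of $x$ is an encoded sequence of rationals $q_k$ with $|x-q_k|\le2^{ -k}$); $\nu^\omega$ represents $\{0,1\}^\omega$ by the sequence itself (Cantor space). A multivalued $g$ is $(\alpha,\beta)$-continuous if there is a continuous $F:\subseteq\{0,1\}^\omega\to\{0,1\}^\omega$ mapping every $\alpha$-name of every $a\in\operatorname{dom}(g)$ to a $\beta$-name of some element of $g(a)$; $g$ is $d$-wise $(\alpha,\beta)$-continuous if $\operatorname{dom}(g)$ can be partitioned into $d$ sets $D$ such that each $g|_D$ is $(\alpha,\beta)$-continuous. -}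

module Defs where

open import Data.Bool using (Bool; true; false)
open import Data.Nat as ℕ using (ℕ; zero; suc; _<ᵇ_)
open import Data.Integer as ℤ using (ℤ; +_; -[1+_])
open import Data.Rational
  using (ℚ; _+_; _*_; _-_; _≤_; _<_; ∣_∣; ½; 0ℚ; 1ℚ; _/_)
open import Data.Rational as Q using ()
open import Data.Fin using (Fin)
open import Data.Product using (Σ; ∃; ∃-syntax; _×_; proj₁)
open import Relation.Binary.PropositionalEquality using (_≡_)

two^ : ℕ → ℚ
two^ zero    = 1ℚ
two^ (suc n) = (+ 2 / 1) * two^ n

half^ : ℕ → ℚ
half^ zero    = 1ℚ
half^ (suc n) = ½ * half^ n

pow2 : ℤ → ℚ
pow2 (+ n)      = two^ n
pow2 -[1+ n ]   = half^ (suc n)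

IsDyadic : ℚ → Set
IsDyadic x = ∃[ r ] ∃[ k ] (x ≡ ((ℤ.+ 2 ℤ.* r ℤ.+ ℤ.+ 1) / 1) * pow2 (ℤ.- k))

InD01 : ℚ → Set
InD01 x = IsDyadic x × (0ℚ ≤ x) × (x < 1ℚ)

D01 : Set
D01 = Σ ℚ InD01

point : D01 → ℚ
point = proj₁

Cantor : Set
Cantor = ℕ → Bool

AgreeUpTo : ℕ → Cantor → Cantor → Set
AgreeUpTo m p p' = ∀ i → i ℕ.< m → p i ≡ p' i

-- The Cauchy representation ρ (restricted to rational points, which is
-- all we need since dom(Adic₂) ⊆ ℚ).

triangle : ℕ → ℕ
triangle zero    = zero
triangle (suc n) = suc n ℕ.+ triangle n

pair : ℕ → ℕ → ℕ
pair i j = triangle (i ℕ.+ j) ℕ.+ j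

zcode : ℤ → ℕ
zcode (+ n)    = 2 ℕ.* n
zcode -[1+ n ] = suc (2 ℕ.* n)

qcode : ℚ → ℕ
qcode q = pair (zcode (ℚ.numerator q)) (ℚ.denominator-1 q)

-- the encoding of a sequence of rationals as an element of Cantor space:
-- track k (positions pair k j) carries the natural number qcode (q k) in
-- unary: 1^{qcode (q k)} 0 0 0 …
encodeSeq : (ℕ → ℚ) → Cantor → Set
encodeSeq q p = ∀ k j → p (pair k j) ≡ (j <ᵇ qcode (q k))

ρName : Cantor → ℚ → Set
ρName p x = ∃[ q ] ((∀ k → ∣ x - q k ∣ ≤ half^ k) × encodeSeq q p)

bit : Bool → ℚ
bit true  = 1ℚ
bit false = 0ℚ

-- partial sums  s_n = Σ_{m=1}^{n} b_m 2^{-m}, where b_m = b (m - 1)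
partialSum : Cantor → ℕ → ℚ
partialSum b zero    = 0ℚ
partialSum b (suc n) = partialSum b n + bit (b n) * half^ (suc n)

SeriesEq : ℚ → Cantor → Set
SeriesEq x b = ∀ (ε : ℚ) → 0ℚ < ε →
  ∃[ N ] (∀ n → N ℕ.≤ n → ∣ partialSum b n - x ∣ < ε)

Adic₂ : D01 → Cantor → Set
Adic₂ a b = SeriesEq (point a) b

-- F is a partial function on Cantor space whose domain is the set of
-- ρ-names of points of S (given as a Σ-type); ν^ω is the identity
-- representation, so F's output is itself the element of {0,1}^ω.

NamesOf : (D01 → Set) → Cantor → Set
NamesOf S p = Σ D01 (λ a → S a × ρName p (point a))

ContinuousOn : (Dom : Cantor → Set) → ((p : Cantor) → Dom p → Cantor) → Set
ContinuousOn Dom F =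
  ∀ p (h : Dom p) (n : ℕ) → ∃[ m ] (∀ p' (h' : Dom p') →
     AgreeUpTo m p p' → AgreeUpTo n (F p h) (F p' h'))

RestrContinuous : (D01 → Set) → Set
RestrContinuous S =
  Σ ((p : Cantor) → NamesOf S p → Cantor) λ F →
    ContinuousOn (NamesOf S) F ×
    (∀ p (h : NamesOf S p) → Adic₂ (proj₁ h) (F p h))

-- d-wise (ρ, ν^ω)-continuity: dom(Adic₂) is partitioned into d sets
-- (given by a class assignment c : D01 → Fin d) such that Adic₂
-- restricted to each class is (ρ, ν^ω)-continuous.
DWiseContinuous : ℕ → Set
DWiseContinuous d =
  Σ (D01 → Fin d) λ c → ∀ (i : Fin d) → RestrContinuous (λ a → c a ≡ i)

-- If x lies on the grid 2^{-n}ℤ, the first n digits of any binary expansion of x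
-- have a partial sum s with s ≤ x ≤ s + 2^{-n}, so x = s or x = s + 2^{-n}. A
-- continuous realiser of Adic₂, run on the constant name of x, outputs the same first
-- n digits on every name that agrees with it long enough, hence for every domain point
-- y close to x, which then satisfies s ≤ y ≤ s + 2^{-n}. So all these y lie on one
-- side of x, and a small dyadic interval on the other side avoids the domain of the
-- realiser. If d continuously realised classes covered a dyadic interval, the class of
-- its centre would thus miss a dyadic subinterval, covered by the remaining d - 1
-- classes; induction on d ends at an interval covered by no class at all.
module Submission where

open import Defs
open import Data.Bool using (true; false)
open import Data.Nat as ℕ using (ℕ; zero; suc; _<ᵇ_; z≤n; s≤s)
import Data.Nat.Properties as ℕP
open import Data.Integer as ℤ using (ℤ; +_; -[1+_])
import Data.Integer.Properties as ℤP
open import Data.Rational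
  using (ℚ; mkℚ; _/_; *≤*; _+_; _*_; -_; _-_; _≤_; _<_; ∣_∣; ½; 0ℚ; 1ℚ; Positive; _≤?_)
open import Data.Rational.Properties
import Data.Rational.Solver as Solver
import Data.Nat.Coprimality as Coprimality
open import Data.Fin using (Fin; punchIn; punchOut) renaming (_≟_ to _≟ᶠ_)
open import Data.Fin.Properties using (¬Fin0; punchIn-punchOut)
open import Data.Empty using (⊥)
open import Data.Product using (∃-syntax; _×_; _,_; proj₁; proj₂)
open import Data.Sum as Sum using (_⊎_; inj₁; inj₂)
open import Function using (_∘_)
open import Relation.Nullary using (¬_; yes; no; contradiction)
open import Relation.Binary.PropositionalEquality

open Solver.+-*-Solver

private variable
  m n : ℕ
  p q r x y : ℚ

fromℤ : ℤ → ℚ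
fromℤ a = a / 1

-- fromℤ a in normal form, on which the arithmetic of ℚ computes.
integer : ℤ → ℚ
integer a = mkℚ a 0 (Coprimality.sym (Coprimality.1-coprimeTo _))

fromℤ≡integer : ∀ a → fromℤ a ≡ integer a
fromℤ≡integer a = ↥p/↧p≡p (integer a)

fromℤ-homo-+ : ∀ a b → fromℤ (a ℤ.+ b) ≡ fromℤ a + fromℤ b
fromℤ-homo-+ a b rewrite fromℤ≡integer a | fromℤ≡integer b =
  cong (_/ 1) (sym (cong₂ ℤ._+_ (ℤP.*-identityʳ a) (ℤP.*-identityʳ b)))

fromℤ-homo-* : ∀ a b → fromℤ (a ℤ.* b) ≡ fromℤ a * fromℤ b
fromℤ-homo-* a b rewrite fromℤ≡integer a | fromℤ≡integer b = refl

fromℤ-homo-neg : ∀ a → fromℤ (ℤ.- a) ≡ - fromℤ a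
fromℤ-homo-neg a =
  trans (fromℤ≡integer (ℤ.- a)) (trans (neg-integer a) (cong -_ (sym (fromℤ≡integer a))))
  where
  neg-integer : ∀ a → integer (ℤ.- a) ≡ - integer a
  neg-integer (+ zero)  = refl
  neg-integer (+ suc n) = refl
  neg-integer -[1+ n ]  = refl

fromℤ-cancel-≤ : ∀ {a b} → fromℤ a ≤ fromℤ b → a ℤ.≤ b
fromℤ-cancel-≤ {a} {b} le with subst₂ _≤_ (fromℤ≡integer a) (fromℤ≡integer b) le
... | *≤* a*1≤b*1 = subst₂ ℤ._≤_ (ℤP.*-identityʳ a) (ℤP.*-identityʳ b) a*1≤b*1

i≤j≤i+1⇒j≡i∨j≡i+1 : ∀ {i j} → i ℤ.≤ j → j ℤ.≤ i ℤ.+ + 1 → j ≡ i ⊎ j ≡ i ℤ.+ + 1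
i≤j≤i+1⇒j≡i∨j≡i+1 {i} {j} i≤j j≤i+1 with j ℤ.≤? i
... | yes j≤i = inj₁ (ℤP.≤-antisym j≤i i≤j)
... | no j≰i  = inj₂ (ℤP.≤-antisym j≤i+1
  (subst (ℤ._≤ j) (ℤP.+-comm (+ 1) i) (ℤP.i<j⇒suc[i]≤j (ℤP.≰⇒> j≰i))))

<⇒≱ : p < q → ¬ q ≤ p
<⇒≱ p<q q≤p = <-irrefl refl (<-≤-trans p<q q≤p)

+-cancelʳ-≤ : ∀ r → p + r ≤ q + r → p ≤ q
+-cancelʳ-≤ {p} {q} r le =
  subst₂ _≤_ (cancel p) (cancel q) (+-monoˡ-≤ (- r) le)
  where cancel = λ z → solve 2 (λ z r → z :+ r :- r := z) refl z r

+-cancelʳ-< : ∀ r → p + r < q + r → p < q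
+-cancelʳ-< {p} {q} r lt =
  subst₂ _<_ (cancel p) (cancel q) (+-monoˡ-< (- r) lt)
  where cancel = λ z → solve 2 (λ z r → z :+ r :- r := z) refl z r

p≤p+q : ∀ p → 0ℚ ≤ q → p ≤ p + q
p≤p+q {q} p 0≤q = subst (_≤ p + q) (+-identityʳ p) (+-monoʳ-≤ p 0≤q)

p<p+q : ∀ p → 0ℚ < q → p < p + q
p<p+q {q} p 0<q = subst (_< p + q) (+-identityʳ p) (+-monoʳ-< p 0<q)

p-q<p : ∀ p → 0ℚ < q → p - q < p
p-q<p {q} p 0<q = +-cancelʳ-< q
  (subst₂ _<_ (solve 2 (λ p q → p := p :- q :+ q) refl p q) refl (p<p+q p 0<q))

p<q⇒0<q-p : p < q → 0ℚ < q - p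
p<q⇒0<q-p {p} {q} p<q = +-cancelʳ-< p
  (subst₂ _<_ (sym (+-identityˡ p)) (solve 2 (λ p q → q := q :- p :+ p) refl p q) p<q)

p+q≤r⇒p≤r-q : ∀ p q → p + q ≤ r → p ≤ r - q
p+q≤r⇒p≤r-q {r} p q le = +-cancelʳ-≤ q
  (subst (p + q ≤_) (solve 2 (λ q r → r := r :- q :+ q) refl q r) le)

p≤∣p∣ : ∀ p → p ≤ ∣ p ∣
p≤∣p∣ p with ∣p∣≡p∨∣p∣≡-p p
... | inj₁ ∣p∣≡p  = ≤-reflexive (sym ∣p∣≡p)
... | inj₂ ∣p∣≡-p = ≤-trans p≤0 (0≤∣p∣ p)
  where
  p≤0 : p ≤ 0ℚ
  p≤0 = +-cancelʳ-≤ (- p) (subst₂ _≤_ (sym (+-inverseʳ p)) (sym (+-identityˡ (- p)))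
          (subst (0ℚ ≤_) ∣p∣≡-p (0≤∣p∣ p)))

-p≤∣p∣ : ∀ p → - p ≤ ∣ p ∣
-p≤∣p∣ p = subst (- p ≤_) (∣-p∣≡∣p∣ p) (p≤∣p∣ (- p))

∣p-q∣<r⇒p<q+r : ∀ p q → ∣ p - q ∣ < r → p < q + r
∣p-q∣<r⇒p<q+r {r} p q lt = +-cancelʳ-< (- q)
  (subst (p - q <_) (solve 2 (λ q r → r := q :+ r :- q) refl q r) (≤-<-trans (p≤∣p∣ (p - q)) lt))

∣p-q∣<r⇒q<p+r : ∀ p q → ∣ p - q ∣ < r → q < p + r
∣p-q∣<r⇒q<p+r {r} p q lt = +-cancelʳ-< (- p) (subst₂ _<_
  (solve 2 (λ p q → :- (p :- q) := q :- p) refl p q) (solve 2 (λ p r → r := p :+ r :- p) refl p r)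
  (≤-<-trans (-p≤∣p∣ (p - q)) lt))

∣p∣≤r : p ≤ r → - p ≤ r → ∣ p ∣ ≤ r
∣p∣≤r {p} p≤r -p≤r with ∣p∣≡p∨∣p∣≡-p p
... | inj₁ ∣p∣≡p  = subst (_≤ _) (sym ∣p∣≡p) p≤r
... | inj₂ ∣p∣≡-p = subst (_≤ _) (sym ∣p∣≡-p) -p≤r

∣p-p∣≤ : ∀ p → 0ℚ ≤ r → ∣ p - p ∣ ≤ r
∣p-p∣≤ {r} p 0≤r = subst (λ z → ∣ z ∣ ≤ r) (sym (+-inverseʳ p)) 0≤r

∣y-x∣≤ : ∀ x y → x - r ≤ y → y ≤ x + r → ∣ y - x ∣ ≤ r
∣y-x∣≤ {r} x y x-r≤y y≤x+r = ∣p∣≤r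
  (+-cancelʳ-≤ x (subst₂ _≤_ (solve 2 (λ y x → y := y :- x :+ x) refl y x)
                             (solve 2 (λ x r → x :+ r := r :+ x) refl x r) y≤x+r))
  (+-cancelʳ-≤ (y - r) (subst₂ _≤_ (solve 3 (λ x r y → x :- r := :- (y :- x) :+ (y :- r)) refl x r y)
                                   (solve 2 (λ r y → y := r :+ (y :- r)) refl r y) x-r≤y))

half^-positive : ∀ n → Positive (half^ n)
half^-positive zero    = _
half^-positive (suc n) = pos*pos⇒pos ½ (half^ n) {{half^-positive n}}

half^-pos : ∀ n → 0ℚ < half^ n
half^-pos n = positive⁻¹ (half^ n) {{half^-positive n}}

half^-nonNeg : ∀ n → 0ℚ ≤ half^ n
half^-nonNeg n = <⇒≤ (half^-pos n)

half^-suc+half^-suc : ∀ n → half^ (suc n) + half^ (suc n) ≡ half^ n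
half^-suc+half^-suc n = solve 1 (λ h → con ½ :* h :+ con ½ :* h := h) refl (half^ n)

half^-suc-≤ : ∀ n → half^ (suc n) ≤ half^ n
half^-suc-≤ n = subst (half^ (suc n) ≤_) (half^-suc+half^-suc n) (p≤p+q (half^ (suc n)) (half^-nonNeg (suc n)))

half^-antitone : m ℕ.≤ n → half^ n ≤ half^ m
half^-antitone {zero}  {zero}  _         = ≤-refl
half^-antitone {zero}  {suc n} _         = ≤-trans (half^-suc-≤ n) (half^-antitone {zero} {n} z≤n)
half^-antitone {suc m} {suc n} (s≤s m≤n) = *-monoˡ-≤-nonNeg ½ (half^-antitone m≤n)

record OnGrid (n : ℕ) (p : ℚ) : Set where
  constructor mkOnGrid
  field
    multiple : ℤ
    p≡multiple*half^ : p ≡ fromℤ multiple * half^ n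

fromℤ-+-* : ∀ a b r → fromℤ (a ℤ.+ b) * r ≡ fromℤ a * r + fromℤ b * r
fromℤ-+-* a b r = trans (cong (_* r) (fromℤ-homo-+ a b)) (*-distribʳ-+ r (fromℤ a) (fromℤ b))

half^-onGrid : ∀ n → OnGrid n (half^ n)
half^-onGrid n = mkOnGrid (+ 1) (sym (*-identityˡ (half^ n)))

onGrid-+ : OnGrid n p → OnGrid n q → OnGrid n (p + q)
onGrid-+ {n} (mkOnGrid a refl) (mkOnGrid b refl) = mkOnGrid (a ℤ.+ b) (sym (fromℤ-+-* a b (half^ n)))

onGrid-neg : OnGrid n p → OnGrid n (- p)
onGrid-neg {n} (mkOnGrid a refl) =
  mkOnGrid (ℤ.- a) (trans (neg-distribˡ-* (fromℤ a) (half^ n)) (cong (_* half^ n) (sym (fromℤ-homo-neg a))))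

onGrid-suc : OnGrid n p → OnGrid (suc n) p
onGrid-suc {n} (mkOnGrid a refl) = mkOnGrid (+ 2 ℤ.* a) (begin
    fromℤ a * half^ n
  ≡⟨ solve 2 (λ a h → a :* h := (con (fromℤ (+ 2)) :* a) :* (con ½ :* h)) refl (fromℤ a) (half^ n) ⟩
    fromℤ (+ 2) * fromℤ a * half^ (suc n)
  ≡⟨ cong (_* half^ (suc n)) (sym (fromℤ-homo-* (+ 2) a)) ⟩
    fromℤ (+ 2 ℤ.* a) * half^ (suc n)
  ∎)
  where open ≡-Reasoning

onGrid-refine : ∀ k → OnGrid n p → OnGrid (k ℕ.+ n) p
onGrid-refine zero    grid = grid
onGrid-refine (suc k) grid = onGrid-suc (onGrid-refine k grid)

onGrid-adjacent : OnGrid n p → OnGrid n x → p ≤ x × x ≤ p + half^ n → x ≡ p ⊎ x ≡ p + half^ n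
onGrid-adjacent {n} (mkOnGrid a refl) (mkOnGrid b refl) (lower , upper) =
  Sum.map (cong (_* half^ n) ∘ cong fromℤ) (λ b≡a+1 → trans (cong (_* half^ n) (cong fromℤ b≡a+1)) (sym next))
    (i≤j≤i+1⇒j≡i∨j≡i+1 (cancel {a} {b} lower) (cancel {b} (subst (fromℤ b * half^ n ≤_) next upper)))
  where
  next : fromℤ a * half^ n + half^ n ≡ fromℤ (a ℤ.+ + 1) * half^ n
  next = trans (cong (λ z → fromℤ a * half^ n + z) (sym (*-identityˡ (half^ n))))
               (sym (fromℤ-+-* a (+ 1) (half^ n)))
  cancel : ∀ {i j} → fromℤ i * half^ n ≤ fromℤ j * half^ n → i ℤ.≤ j
  cancel = fromℤ-cancel-≤ ∘ *-cancelʳ-≤-pos (half^ n) {{half^-positive n}}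

bit*half^-onGrid : ∀ c n → OnGrid n (bit c * half^ n)
bit*half^-onGrid true  n = mkOnGrid (+ 1) refl
bit*half^-onGrid false n = mkOnGrid (+ 0) refl

partialSum-onGrid : ∀ b n → OnGrid n (partialSum b n)
partialSum-onGrid b zero    = mkOnGrid (+ 0) refl
partialSum-onGrid b (suc n) = onGrid-+ (onGrid-suc (partialSum-onGrid b n)) (bit*half^-onGrid (b n) (suc n))

partialSum-agree : ∀ n {b b′} → AgreeUpTo n b b′ → partialSum b n ≡ partialSum b′ n
partialSum-agree zero    agree = refl
partialSum-agree (suc n) agree = cong₂ (λ s c → s + bit c * half^ (suc n))
  (partialSum-agree n (λ i i<n → agree i (ℕP.m<n⇒m<1+n i<n))) (agree n ℕP.≤-refl)

bit*half^-nonNeg : ∀ c n → 0ℚ ≤ bit c * half^ n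
bit*half^-nonNeg true  n = subst (0ℚ ≤_) (sym (*-identityˡ (half^ n))) (half^-nonNeg n)
bit*half^-nonNeg false n = ≤-reflexive (sym (*-zeroˡ (half^ n)))

bit*half^-≤ : ∀ c n → bit c * half^ n ≤ half^ n
bit*half^-≤ true  n = ≤-reflexive (*-identityˡ (half^ n))
bit*half^-≤ false n = subst (_≤ half^ n) (sym (*-zeroˡ (half^ n))) (half^-nonNeg n)

partialSum-mono : ∀ b k n → partialSum b n ≤ partialSum b (k ℕ.+ n)
partialSum-mono b zero    n = ≤-refl
partialSum-mono b (suc k) n =
  ≤-trans (partialSum-mono b k n)
          (p≤p+q (partialSum b (k ℕ.+ n)) (bit*half^-nonNeg (b (k ℕ.+ n)) (suc (k ℕ.+ n))))

partialSum+half^-antitone : ∀ b k n → partialSum b (k ℕ.+ n) + half^ (k ℕ.+ n) ≤ partialSum b n + half^ n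
partialSum+half^-antitone b zero    n = ≤-refl
partialSum+half^-antitone b (suc k) n = ≤-trans one-step (partialSum+half^-antitone b k n)
  where
  open ≤-Reasoning
  N = k ℕ.+ n
  s = partialSum b N
  one-step : s + bit (b N) * half^ (suc N) + half^ (suc N) ≤ s + half^ N
  one-step = begin
      s + bit (b N) * half^ (suc N) + half^ (suc N)
    ≤⟨ +-monoˡ-≤ (half^ (suc N)) (+-monoʳ-≤ s (bit*half^-≤ (b N) (suc N))) ⟩
      s + half^ (suc N) + half^ (suc N)
    ≡⟨ +-assoc s (half^ (suc N)) (half^ (suc N)) ⟩
      s + (half^ (suc N) + half^ (suc N))
    ≡⟨ cong (λ z → s + z) (half^-suc+half^-suc N) ⟩
      s + half^ N
    ∎

-- Defs.SeriesEq x b unfolds to ConvergesTo (partialSum b) x.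
ConvergesTo : (ℕ → ℚ) → ℚ → Set
ConvergesTo u x = ∀ ε → 0ℚ < ε → ∃[ N ] (∀ n → N ℕ.≤ n → ∣ u n - x ∣ < ε)

limit-≥ : ∀ {u} → ConvergesTo u x → (∀ k → r ≤ u (k ℕ.+ n)) → r ≤ x
limit-≥ {x} {r} {n} {u} conv bound with r ≤? x
... | yes r≤x = r≤x
... | no r≰x  = contradiction (bound N) (<⇒≱ u<r)
  where
  ε-pos = p<q⇒0<q-p (≰⇒> r≰x)
  N = proj₁ (conv (r - x) ε-pos)
  u<r : u (N ℕ.+ n) < r
  u<r = subst (u (N ℕ.+ n) <_) (solve 2 (λ x r → x :+ (r :- x) := r) refl x r)
    (∣p-q∣<r⇒p<q+r (u (N ℕ.+ n)) x (proj₂ (conv (r - x) ε-pos) (N ℕ.+ n) (ℕP.m≤m+n N n)))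

limit-≤ : ∀ {u} → ConvergesTo u x → (∀ k → u (k ℕ.+ n) ≤ r) → x ≤ r
limit-≤ {x} {n} {r} {u} conv bound with x ≤? r
... | yes x≤r = x≤r
... | no x≰r  = contradiction (bound N) (<⇒≱ r<u)
  where
  ε-pos = p<q⇒0<q-p (≰⇒> x≰r)
  N = proj₁ (conv (x - r) ε-pos)
  r<u : r < u (N ℕ.+ n)
  r<u = +-cancelʳ-< {r} {u (N ℕ.+ n)} (x - r)
    (subst (_< u (N ℕ.+ n) + (x - r)) (solve 2 (λ x r → x := r :+ (x :- r)) refl x r)
      (∣p-q∣<r⇒q<p+r (u (N ℕ.+ n)) x (proj₂ (conv (x - r) ε-pos) (N ℕ.+ n) (ℕP.m≤m+n N n))))

partialSum-bounds : ∀ {b} → SeriesEq x b → ∀ n → partialSum b n ≤ x × x ≤ partialSum b n + half^ n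
partialSum-bounds {b = b} series n =
  limit-≥ {u = partialSum b} series (λ k → partialSum-mono b k n) ,
  limit-≤ {u = partialSum b} series (λ k →
    ≤-trans (p≤p+q (partialSum b (k ℕ.+ n)) (half^-nonNeg (k ℕ.+ n))) (partialSum+half^-antitone b k n))

-- Inverse of Defs.pair: it walks each antidiagonal i + j = s from (s , 0) to (0 , s).
unpair-step : ℕ × ℕ → ℕ × ℕ
unpair-step (zero  , j) = suc j , 0
unpair-step (suc i , j) = i , suc j

unpair : ℕ → ℕ × ℕ
unpair zero    = 0 , 0
unpair (suc n) = unpair-step (unpair n)

pair-sucʳ : ∀ i j → pair i (suc j) ≡ suc (pair (suc i) j)
pair-sucʳ i j rewrite ℕP.+-suc i j = ℕP.+-suc (triangle (suc (i ℕ.+ j))) j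

pair-suc-zero : ∀ i → pair (suc i) 0 ≡ suc (pair 0 i)
pair-suc-zero i rewrite ℕP.+-identityʳ i | ℕP.+-identityʳ (suc (i ℕ.+ triangle i)) =
  cong suc (ℕP.+-comm i (triangle i))

unpair-pair : ∀ i j → unpair (pair i j) ≡ (i , j)
unpair-pair i j = on-antidiagonal (i ℕ.+ j) i j refl
  where
  on-antidiagonal : ∀ s i j → i ℕ.+ j ≡ s → unpair (pair i j) ≡ (i , j)
  on-antidiagonal s i (suc j) i+j≡s = trans (cong unpair (pair-sucʳ i j))
    (cong unpair-step (on-antidiagonal s (suc i) j (trans (sym (ℕP.+-suc i j)) i+j≡s)))
  on-antidiagonal zero    zero    zero _     = refl
  on-antidiagonal (suc s) (suc i) zero i+0≡s = trans (cong unpair (pair-suc-zero i))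
    (cong unpair-step (on-antidiagonal s 0 i (trans (sym (ℕP.+-identityʳ i)) (ℕP.suc-injective i+0≡s))))

unpair-sum-≤ : ∀ n → proj₁ (unpair n) ℕ.+ proj₂ (unpair n) ℕ.≤ n
unpair-sum-≤ zero = z≤n
unpair-sum-≤ (suc n) with unpair n | unpair-sum-≤ n
... | zero  , j | j≤n   = s≤s (subst (ℕ._≤ n) (sym (ℕP.+-identityʳ j)) j≤n)
... | suc i , j | i+j<n = ℕP.m≤n⇒m≤1+n (subst (ℕ._≤ n) (sym (ℕP.+-suc i j)) i+j<n)

encode : (ℕ → ℚ) → Cantor
encode q n = proj₂ (unpair n) <ᵇ qcode (q (proj₁ (unpair n)))

encode-encodeSeq : ∀ q → encodeSeq q (encode q)
encode-encodeSeq q k j rewrite unpair-pair k j = refl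

encode-agree : ∀ {q q′} → (∀ k → k ℕ.< m → q k ≡ q′ k) → AgreeUpTo m (encode q) (encode q′)
encode-agree agree i i<m = cong (λ r → proj₂ (unpair i) <ᵇ qcode r)
  (agree _ (ℕP.≤-<-trans (ℕP.≤-trans (ℕP.m≤m+n _ _) (unpair-sum-≤ i)) i<m))

switch : ℕ → ℚ → ℚ → ℕ → ℚ
switch m x y k with k ℕ.<? m
... | yes _ = x
... | no _  = y

switch-prefix : ∀ k → k ℕ.< m → switch m x y k ≡ x
switch-prefix {m} k k<m with k ℕ.<? m
... | yes _   = refl
... | no k≮m  = contradiction k<m k≮m

switch-cauchy : ∣ y - x ∣ ≤ half^ m → ∀ k → ∣ y - switch m x y k ∣ ≤ half^ k
switch-cauchy {y = y} {m = m} close k with k ℕ.<? m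
... | yes k<m = ≤-trans close (half^-antitone (ℕP.<⇒≤ k<m))
... | no _    = ∣p-p∣≤ y (half^-nonNeg k)

digits-stable : ∀ {S} → RestrContinuous S → ∀ a → S a → ∀ n →
  ∃[ s ] ∃[ m ] (OnGrid n s ×
    (∀ b → S b → ∣ point b - point a ∣ ≤ half^ m → s ≤ point b × point b ≤ s + half^ n))
digits-stable {S} (F , continuous , realises) a Sa n =
  partialSum (F name-a named-a) n , modulus , partialSum-onGrid (F name-a named-a) n , stable
  where
  x₀ = point a
  seq-a : ℕ → ℚ
  seq-a _ = x₀
  name-a = encode seq-a
  named-a : NamesOf S name-a
  named-a = a , Sa , seq-a , (λ k → ∣p-p∣≤ x₀ (half^-nonNeg k)) , encode-encodeSeq seq-a
  modulus = proj₁ (continuous name-a named-a n)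
  stable : ∀ b → S b → ∣ point b - x₀ ∣ ≤ half^ modulus →
    partialSum (F name-a named-a) n ≤ point b × point b ≤ partialSum (F name-a named-a) n + half^ n
  stable b Sb close = subst (λ s → s ≤ point b × point b ≤ s + half^ n)
    (sym (partialSum-agree n same-digits)) (partialSum-bounds (realises name-b named-b) n)
    where
    seq-b = switch modulus x₀ (point b)
    name-b = encode seq-b
    named-b : NamesOf S name-b
    named-b = b , Sb , seq-b , switch-cauchy {y = point b} {x = x₀} close , encode-encodeSeq seq-b
    same-digits : AgreeUpTo n (F name-a named-a) (F name-b named-b)
    same-digits = proj₂ (continuous name-a named-a n) name-b named-b
      (encode-agree (λ k k<modulus → sym (switch-prefix k k<modulus)))

OneSided : (D01 → Set) → ℚ → ℕ → Set
OneSided S x m = (∀ b → S b → ∣ point b - x ∣ ≤ half^ m → x ≤ point b)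
               ⊎ (∀ b → S b → ∣ point b - x ∣ ≤ half^ m → point b ≤ x)

one-sided : ∀ {S} → RestrContinuous S → ∀ a → S a → OnGrid n (point a) → ∃[ m ] OneSided S (point a) m
one-sided {n} continuous a Sa grid =
  let s , m , s-grid , stable = digits-stable continuous a Sa n in
  m , Sum.map (λ x≡s   b Sb close → subst (_≤ point b) (sym x≡s)   (proj₁ (stable b Sb close)))
              (λ x≡s+h b Sb close → subst (point b ≤_) (sym x≡s+h) (proj₂ (stable b Sb close)))
              (onGrid-adjacent s-grid grid (stable a Sa (∣p-p∣≤ (point a) (half^-nonNeg m))))

record DyadicInterval : Set where
  constructor ⟨_,_⟩
  field
    index : ℤ
    level : ℕ

open DyadicInterval

left right centre : DyadicInterval → ℚ
left I   = fromℤ (index I) * half^ (level I)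
right I  = left I + half^ (level I)
centre I = fromℤ (+ 2 ℤ.* index I ℤ.+ + 1) * half^ (suc (level I))

_∈ᴵ_ : ℚ → DyadicInterval → Set
y ∈ᴵ I = left I ≤ y × y ≤ right I

_⊆ᴵ_ : DyadicInterval → DyadicInterval → Set
J ⊆ᴵ I = left I ≤ left J × right J ≤ right I

∈ᴵ-⊆ : ∀ {J I} → y ∈ᴵ J → J ⊆ᴵ I → y ∈ᴵ I
∈ᴵ-⊆ (lJ≤y , y≤rJ) (lI≤lJ , rJ≤rI) = ≤-trans lI≤lJ lJ≤y , ≤-trans y≤rJ rJ≤rI

InUnit : DyadicInterval → Set
InUnit I = 0ℚ ≤ left I × right I ≤ 1ℚ

InUnit-⊆ : ∀ {J I} → J ⊆ᴵ I → InUnit I → InUnit J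
InUnit-⊆ (lI≤lJ , rJ≤rI) (0≤lI , rI≤1) = ≤-trans 0≤lI lI≤lJ , ≤-trans rJ≤rI rI≤1

cell : OnGrid n p → DyadicInterval
cell {n} (mkOnGrid a _) = ⟨ a , n ⟩

left-cell : (grid : OnGrid n p) → left (cell grid) ≡ p
left-cell (mkOnGrid _ p≡) = sym p≡

centre≡left+half^ : ∀ I → centre I ≡ left I + half^ (suc (level I))
centre≡left+half^ ⟨ a , n ⟩ = begin
    fromℤ (+ 2 ℤ.* a ℤ.+ + 1) * half^ (suc n)
  ≡⟨ cong (_* half^ (suc n)) (fromℤ-homo-+ (+ 2 ℤ.* a) (+ 1)) ⟩
    (fromℤ (+ 2 ℤ.* a) + 1ℚ) * half^ (suc n)
  ≡⟨ cong (λ z → (z + 1ℚ) * half^ (suc n)) (fromℤ-homo-* (+ 2) a) ⟩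
    (fromℤ (+ 2) * fromℤ a + 1ℚ) * (½ * half^ n)
  ≡⟨ solve 2 (λ a h → (con (fromℤ (+ 2)) :* a :+ con 1ℚ) :* (con ½ :* h) := a :* h :+ con ½ :* h)
       refl (fromℤ a) (half^ n) ⟩
    fromℤ a * half^ n + half^ (suc n)
  ∎
  where open ≡-Reasoning

right≡centre+half^ : ∀ I → right I ≡ centre I + half^ (suc (level I))
right≡centre+half^ I = begin
    left I + half^ M
  ≡⟨ cong (λ z → left I + z) (sym (half^-suc+half^-suc M)) ⟩
    left I + (half^ (suc M) + half^ (suc M))
  ≡⟨ sym (+-assoc (left I) _ _) ⟩
    left I + half^ (suc M) + half^ (suc M)
  ≡⟨ cong (_+ half^ (suc M)) (sym (centre≡left+half^ I)) ⟩
    centre I + half^ (suc M)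
  ∎
  where
  open ≡-Reasoning
  M = level I

centre-onGrid : ∀ I → OnGrid (suc (level I)) (centre I)
centre-onGrid I = mkOnGrid (+ 2 ℤ.* index I ℤ.+ + 1) refl

centre∈ᴵ : ∀ I → centre I ∈ᴵ I
centre∈ᴵ I =
  subst (left I ≤_) (sym (centre≡left+half^ I)) (p≤p+q (left I) (half^-nonNeg (suc (level I)))) ,
  subst (centre I ≤_) (sym (right≡centre+half^ I)) (p≤p+q (centre I) (half^-nonNeg (suc (level I))))

midpoint : (I : DyadicInterval) → InUnit I → D01
midpoint I (0≤left , right≤1) =
  centre I , (index I , + suc (level I) , refl) ,
  ≤-trans 0≤left (proj₁ (centre∈ᴵ I)) ,
  <-≤-trans (subst (centre I <_) (sym (right≡centre+half^ I)) (p<p+q (centre I) (half^-pos (suc (level I)))))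
            right≤1

-- The cells [c - 2g, c - g] and [c + g, c + 2g] flanking the centre c of I, with
-- g = 2^{-(m+M+2)} for M the level of I, lie in I and within 2^{-m} of c.
module Flanks (I : DyadicInterval) (m : ℕ) where
  private
    M = level I
    H = half^ (suc M)
    c = centre I
    g = half^ (suc (m ℕ.+ suc M))
    g-pos = half^-pos (suc (m ℕ.+ suc M))
    c-grid : OnGrid (suc (m ℕ.+ suc M)) c
    c-grid = onGrid-refine (suc m) (centre-onGrid I)
    g-grid = half^-onGrid (suc (m ℕ.+ suc M))
    below-grid = onGrid-+ c-grid (onGrid-neg (onGrid-+ g-grid g-grid))
    above-grid = onGrid-+ c-grid g-grid

    2g≡ : g + g ≡ half^ (m ℕ.+ suc M)
    2g≡ = half^-suc+half^-suc (m ℕ.+ suc M)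

    2g-pos : 0ℚ < g + g
    2g-pos = subst (0ℚ <_) (sym 2g≡) (half^-pos (m ℕ.+ suc M))

    2g≤H : g + g ≤ H
    2g≤H = subst (_≤ H) (sym 2g≡) (half^-antitone (ℕP.m≤n+m (suc M) m))

    close : c - (g + g) ≤ y → y ≤ c + (g + g) → ∣ y - c ∣ ≤ half^ m
    close {y} lower upper = ≤-trans (∣y-x∣≤ c y lower upper)
      (subst (_≤ half^ m) (sym 2g≡) (half^-antitone (ℕP.m≤m+n m (suc M))))

    open ≤-Reasoning

  below above : DyadicInterval
  below = cell below-grid
  above = cell above-grid

  private
    right-below<c : right below < c
    right-below<c = begin-strict
      right below         ≡⟨ cong (_+ g) (left-cell below-grid) ⟩
      c - (g + g) + g     ≡⟨ solve 2 (λ c g → c :- (g :+ g) :+ g := c :- g) refl c g ⟩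
      c - g               <⟨ p-q<p c g-pos ⟩
      c                   ∎

  below-⊆ : below ⊆ᴵ I
  below-⊆ = subst (left I ≤_) (sym (left-cell below-grid)) (p+q≤r⇒p≤r-q (left I) (g + g)
              (subst (left I + (g + g) ≤_) (sym (centre≡left+half^ I)) (+-monoʳ-≤ (left I) 2g≤H))) ,
            ≤-trans (<⇒≤ right-below<c) (proj₂ (centre∈ᴵ I))

  below-< : y ∈ᴵ below → y < c
  below-< (_ , upper) = ≤-<-trans upper right-below<c

  below-close : y ∈ᴵ below → ∣ y - c ∣ ≤ half^ m
  below-close {y} y∈ = close (subst (_≤ y) (left-cell below-grid) (proj₁ y∈))
                             (≤-trans (<⇒≤ (below-< y∈)) (p≤p+q c (<⇒≤ 2g-pos)))

  above-⊆ : above ⊆ᴵ I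
  above-⊆ = ≤-trans (proj₁ (centre∈ᴵ I))
              (≤-trans (p≤p+q c (<⇒≤ g-pos)) (≤-reflexive (sym (left-cell above-grid)))) ,
            (begin
              right above       ≡⟨ cong (_+ g) (left-cell above-grid) ⟩
              c + g + g         ≡⟨ +-assoc c g g ⟩
              c + (g + g)       ≤⟨ +-monoʳ-≤ c 2g≤H ⟩
              c + H             ≡⟨ sym (right≡centre+half^ I) ⟩
              right I           ∎)

  above-> : y ∈ᴵ above → c < y
  above-> {y} (lower , _) = begin-strict
    c                   <⟨ p<p+q c g-pos ⟩
    c + g               ≡⟨ sym (left-cell above-grid) ⟩
    left above          ≤⟨ lower ⟩
    y                   ∎

  above-close : y ∈ᴵ above → ∣ y - c ∣ ≤ half^ m
  above-close {y} y∈ = close (≤-trans (<⇒≤ (p-q<p c 2g-pos)) (<⇒≤ (above-> y∈)))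
                             (subst (y ≤_) (trans (cong (_+ g) (left-cell above-grid)) (+-assoc c g g)) (proj₂ y∈))

avoiding-subinterval : ∀ {S} → RestrContinuous S → ∀ I (unit : InUnit I) → S (midpoint I unit) →
  ∃[ J ] (J ⊆ᴵ I × (∀ a → point a ∈ᴵ J → ¬ S a))
avoiding-subinterval {S} continuous I unit Sc =
  flank (one-sided continuous (midpoint I unit) Sc (centre-onGrid I))
  where
  flank : ∃[ m ] OneSided S (centre I) m → ∃[ J ] (J ⊆ᴵ I × (∀ a → point a ∈ᴵ J → ¬ S a))
  flank (m , inj₁ right-of-c) =
    below , below-⊆ , λ a a∈ Sa → <⇒≱ (below-< a∈) (right-of-c a Sa (below-close a∈))
    where open Flanks I m
  flank (m , inj₂ left-of-c) =
    above , above-⊆ , λ a a∈ Sa → <⇒≱ (above-> a∈) (left-of-c a Sa (above-close a∈))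
    where open Flanks I m

Covers : ∀ {d} → (Fin d → D01 → Set) → DyadicInterval → Set
Covers P I = ∀ a → point a ∈ᴵ I → ∃[ i ] P i a

covers-punchIn : ∀ {d J} (P : Fin (suc d) → D01 → Set) i →
  (∀ a → point a ∈ᴵ J → ¬ P i a) → Covers P J → Covers (P ∘ punchIn i) J
covers-punchIn P i avoid cover a a∈J = other-class (cover a a∈J)
  where
  other-class : ∃[ j ] P j a → ∃[ j ] P (punchIn i j) a
  other-class (j , Pja) with i ≟ᶠ j
  ... | yes refl = contradiction Pja (avoid a a∈J)
  ... | no i≢j   = punchOut i≢j , subst (λ k → P k a) (sym (punchIn-punchOut i≢j)) Pja

no-continuous-cover : ∀ d (P : Fin d → D01 → Set) → (∀ i → RestrContinuous (P i)) →
  ∀ I → InUnit I → ¬ Covers P I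
no-continuous-cover zero P _ I unit cover = ¬Fin0 (proj₁ (cover (midpoint I unit) (centre∈ᴵ I)))
no-continuous-cover (suc d) P continuous I unit cover = drop-class (cover (midpoint I unit) (centre∈ᴵ I))
  where
  drop-class : ∃[ i ] P i (midpoint I unit) → ⊥
  drop-class (i , Pic) = recurse (avoiding-subinterval (continuous i) I unit Pic)
    where
    recurse : ∃[ J ] (J ⊆ᴵ I × (∀ a → point a ∈ᴵ J → ¬ P i a)) → ⊥
    recurse (J , J⊆I , avoid) =
      no-continuous-cover d (P ∘ punchIn i) (continuous ∘ punchIn i) J (InUnit-⊆ {J} {I} J⊆I unit)
        (covers-punchIn {J = J} P i avoid (λ a a∈J → cover a (∈ᴵ-⊆ {J = J} {I} a∈J J⊆I)))

proposition4 : (d : ℕ) → ¬ DWiseContinuous d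
proposition4 d (class , continuous) =
  no-continuous-cover d (λ i a → class a ≡ i) continuous ⟨ + 0 , 0 ⟩ (≤-refl , ≤-refl)
    (λ a _ → class a , refl)
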